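{- Let $G=(V,E)$ be a finite simple unicyclic graph with $m=|E|$ edges $e_1,\dots,e_m$, and set $p \coloneqq \operatorname{ucd}(G)$. Then for every $i=1,\ldots,m$, the graph $G_i=(V,E\setminus\{e_i\})$ is one of the following: (1) a tree; (2) a graph with two connected components, one of which is a unicyclic graph with $p$ branches, and the other a forest; (3) a graph with two connected components, one of which is a unicyclic graph with $p-1$ branches, and the other a forest.
   Context: All graphs are finite and simple. A graph is unicyclic if it is connected and contains exactly one cycle; for a unicyclic graph $G$, $C(G)$ denotes its unique cycle. A branch of a unicyclic graph $G$ is a subgraph $B$ of one of the trees of $G$ hanging off the cycle (i.e. a subgraph of $G$ contained in the subtree attached to a vertex of $C(G)$) such that: $B$ has at least one edge; $B$ shares exactly one vertex $v$ with $C(G)$; $B$ is joined to $v$ by only one edge; and $B$ is not a proper subgraph of any other branch. Define $\operatorname{ucd}(G) := \sum_{v\in V(C(G)),\ d_G(v)\geq 3} (d_G(v)-2)$, where $d_G(v)$ is the degree of $v$; this equals the number of branches of $G$. -}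

module Defs where

open import Data.Bool using (Bool; true; false; _∧_; _∨_; not; if_then_else_)
open import Data.Nat using (ℕ; zero; suc; _∸_; _≤_; _≤ᵇ_)
open import Data.Fin using (Fin)
open import Data.Fin.Properties using () renaming (_≟_ to _≟ᶠ_)
open import Data.List using (List; []; _∷_; _++_; [_]; length; map; allFin)
open import Data.Nat.ListAction using (sum)
open import Data.List.Relation.Unary.All using (All)
open import Data.List.Relation.Unary.Unique.Propositional using (Unique)
open import Data.List.Relation.Unary.Linked using (Linked)
open import Data.Product using (Σ; _×_; ∃)
open import Data.Sum using (_⊎_)
open import Relation.Binary.PropositionalEquality using (_≡_)
open import Relation.Nullary using (¬_)
open import Relation.Nullary.Decidable using (⌊_⌋)

Graph : ℕ → Set
Graph n = Fin n → Fin n → Bool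

Simple : {n : ℕ} → Graph n → Set
Simple {n} G = ((x y : Fin n) → G x y ≡ G y x) × ((x : Fin n) → G x x ≡ false)

VSet : ℕ → Set
VSet n = Fin n → Bool

full : {n : ℕ} → VSet n
full _ = true

_==_ : {n : ℕ} → Fin n → Fin n → Bool
x == y = ⌊ x ≟ᶠ y ⌋

deleteEdge : {n : ℕ} → Graph n → Fin n → Fin n → Graph n
deleteEdge G u v x y = G x y ∧ not ((x == u ∧ y == v) ∨ (x == v ∧ y == u))

data Walk {n : ℕ} (G : Graph n) (S : VSet n) : Fin n → Fin n → Set where
  here : {x : Fin n} → S x ≡ true → Walk G S x x
  step : {x z y : Fin n} → S x ≡ true → G x z ≡ true → Walk G S z y → Walk G S x y

Connected : {n : ℕ} → Graph n → VSet n → Set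
Connected {n} G S = (x y : Fin n) → S x ≡ true → S y ≡ true → Walk G S x y

closeUp : {A : Set} → List A → List A
closeUp [] = []
closeUp (x ∷ xs) = x ∷ (xs ++ [ x ])

IsCycle : {n : ℕ} → Graph n → VSet n → List (Fin n) → Set
IsCycle G S c =
  (3 ≤ length c) × Unique c × All (λ x → S x ≡ true) c
    × Linked (λ x y → G x y ≡ true) (closeUp c)

data Consec {A : Set} : List A → A → A → Set where
  now  : {x y : A} {xs : List A} → Consec (x ∷ y ∷ xs) x y
  later : {z x y : A} {xs : List A} → Consec xs x y → Consec (z ∷ xs) x y

CycEdge : {n : ℕ} → List (Fin n) → Fin n → Fin n → Set
CycEdge c u v = Consec (closeUp c) u v ⊎ Consec (closeUp c) v u

SameCycle : {n : ℕ} → List (Fin n) → List (Fin n) → Set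
SameCycle {n} c c' =
  (u v : Fin n) → (CycEdge c u v → CycEdge c' u v) × (CycEdge c' u v → CycEdge c u v)

UniqueCycle : {n : ℕ} → Graph n → VSet n → List (Fin n) → Set
UniqueCycle G S c = IsCycle G S c × ((c' : List _) → IsCycle G S c' → SameCycle c c')

Acyclic : {n : ℕ} → Graph n → VSet n → Set
Acyclic G S = (c : List _) → ¬ IsCycle G S c

Forest : {n : ℕ} → Graph n → VSet n → Set
Forest = Acyclic

Tree : {n : ℕ} → Graph n → Set
Tree G = Connected G full × Acyclic G full

degIn : {n : ℕ} → Graph n → VSet n → Fin n → ℕ
degIn {n} G S v = sum (map (λ w → if G v w ∧ S w then 1 else 0) (allFin n))

ucd : {n : ℕ} → Graph n → VSet n → List (Fin n) → ℕ
ucd G S c = sum (map (λ v → if 3 ≤ᵇ degIn G S v then degIn G S v ∸ 2 else 0) c)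

IsComponent : {n : ℕ} → Graph n → VSet n → Set
IsComponent {n} G S =
  (∃ λ x → S x ≡ true) × Connected G S
    × ((x y : Fin n) → S x ≡ true → G x y ≡ true → S y ≡ true)

TwoComponents : {n : ℕ} → Graph n → VSet n → VSet n → Set
TwoComponents {n} G S T =
  IsComponent G S × IsComponent G T × ((x : Fin n) → T x ≡ not (S x))

UnicyclicWithBranches : {n : ℕ} → Graph n → VSet n → ℕ → Set
UnicyclicWithBranches G S k =
  Connected G S × Σ (List _) (λ c → UniqueCycle G S c × ucd G S c ≡ k)

{-# OPTIONS --safe #-}
module Submission where

-- Let G' be G without the edge uv, and C the cycle of G.  Every vertex of G
-- still reaches u or v in G': follow a walk from u and keep its part after
-- the last visit to u or v.
--
-- If uv lies on C, the rest of C joins v to u in G', so G' is connected; it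
-- is acyclic because its cycles are cycles of G, hence equal to C, which
-- uses the missing edge.
--
-- If uv is not on C, then C survives in G' and uv is a bridge: a path from v
-- to u in G' closed up by uv would be a second cycle of G.  So G' has exactly
-- two components, the vertices reachable from u and those reachable from v.
-- The one containing C is unicyclic; the other is a forest, since its cycles
-- would have to meet C.  Inside the first component degrees are those of G
-- except at the endpoint r of uv lying in it, which lost one edge; so only
-- the term of r in ucd can change, and by at most one.

open import Defs
open import Data.Nat using (ℕ; zero; suc; _+_; _∸_; _≤_; _≤ᵇ_; s≤s; z≤n)
open import Data.Nat.Properties using (+-suc; +-comm)
open import Data.Nat.ListAction using (sum)
open import Data.Fin using (Fin)
open import Data.Fin.Properties using () renaming (_≟_ to _≟ᶠ_)
open import Data.Bool using (Bool; true; false; _∧_; _∨_; not; if_then_else_)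
open import Data.Bool.Properties using (∧-comm; ∨-comm; ∧-identityʳ; ∧-zeroʳ)
open import Data.List using (List; []; _∷_; _++_; [_]; _∷ʳ_; length; map; allFin)
open import Data.List.Properties using (++-assoc; ++-identityʳ; length-++; map-cong; map-cong-local)
open import Data.List.Membership.Propositional using (_∈_)
open import Data.List.Membership.Propositional.Properties using (∈-++⁻; ∈-++⁺ʳ; ∈-allFin)
import Data.List.Membership.DecPropositional as DecMembership
open import Data.List.Relation.Unary.Any using (here; there)
open import Data.List.Relation.Unary.All as All using (All; []; _∷_)
open import Data.List.Relation.Unary.All.Properties using (++⁻ˡ; ∷ʳ⁺; ¬Any⇒All¬)
open import Data.List.Relation.Unary.AllPairs using ([]; _∷_)
open import Data.List.Relation.Unary.Unique.Propositional using (Unique)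
open import Data.List.Relation.Unary.Unique.Propositional.Properties using (allFin⁺) renaming (++⁺ to Unique-++⁺)
open import Data.List.Relation.Unary.Linked as Linked using (Linked; []; [-]; _∷_)
open import Data.Product using (Σ; ∃; ∃₂; _×_; _,_; proj₁; proj₂; map₂)
open import Data.Sum using (_⊎_; inj₁; inj₂; [_,_]′; swap) renaming (map to ⊎-map)
open import Data.Empty using (⊥-elim)
open import Function using (_∘_; id)
open import Relation.Binary.Definitions using (DecidableEquality)
open import Relation.Binary.PropositionalEquality
  using (_≡_; _≢_; refl; sym; trans; cong; cong₂; subst; module ≡-Reasoning)
open import Relation.Nullary using (¬_; Dec; yes; no; does)
open import Relation.Nullary.Decidable using (dec-true; dec-false; map′; _×-dec_; _⊎-dec_)

module _ {A : Set} where

  consec⇒∈ˡ : ∀ {L : List A} {a b} → Consec L a b → a ∈ L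
  consec⇒∈ˡ now = here refl
  consec⇒∈ˡ (later C) = there (consec⇒∈ˡ C)

  consec⇒∈ʳ : ∀ {L : List A} {a b} → Consec L a b → b ∈ L
  consec⇒∈ʳ now = there (here refl)
  consec⇒∈ʳ (later C) = there (consec⇒∈ʳ C)

  ∈-closeUp⁻ : ∀ {L : List A} {a} → a ∈ closeUp L → a ∈ L
  ∈-closeUp⁻ {x ∷ xs} (here a≡x) = here a≡x
  ∈-closeUp⁻ {x ∷ xs} (there a∈) with ∈-++⁻ xs a∈
  ... | inj₁ a∈xs = there a∈xs
  ... | inj₂ (here a≡x) = here a≡x

  ∈⇒consec-∷ʳ : ∀ {L : List A} {a} d → a ∈ L → ∃ λ b → Consec (L ∷ʳ d) a b
  ∈⇒consec-∷ʳ {_ ∷ []} d (here refl) = d , now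
  ∈⇒consec-∷ʳ {_ ∷ y ∷ _} d (here refl) = y , now
  ∈⇒consec-∷ʳ {_ ∷ _} d (there a∈) = map₂ later (∈⇒consec-∷ʳ d a∈)

  consec-∷ʳ⁻ : ∀ (L : List A) {d a b} → Consec (L ∷ʳ d) a b →
               (∃₂ λ P Q → L ≡ P ++ a ∷ b ∷ Q) ⊎ (∃ λ P → L ≡ P ∷ʳ a × b ≡ d)
  consec-∷ʳ⁻ [] (later ())
  consec-∷ʳ⁻ (x ∷ []) now = inj₂ ([] , refl , refl)
  consec-∷ʳ⁻ (x ∷ y ∷ L) now = inj₁ ([] , L , refl)
  consec-∷ʳ⁻ (x ∷ L) (later C) with consec-∷ʳ⁻ L C
  ... | inj₁ (P , Q , refl) = inj₁ (x ∷ P , Q , refl)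
  ... | inj₂ (P , refl , b≡d) = inj₂ (x ∷ P , refl , b≡d)

  consec? : DecidableEquality A → ∀ L a b → Dec (Consec L a b)
  consec? _≟_ [] a b = no λ ()
  consec? _≟_ (x ∷ []) a b = no λ { (later ()) }
  consec? _≟_ (x ∷ y ∷ L) a b = map′ fold unfold ((x ≟ a ×-dec y ≟ b) ⊎-dec consec? _≟_ (y ∷ L) a b)
    where
      fold : (x ≡ a × y ≡ b) ⊎ Consec (y ∷ L) a b → Consec (x ∷ y ∷ L) a b
      fold (inj₁ (refl , refl)) = now
      fold (inj₂ C) = later C
      unfold : Consec (x ∷ y ∷ L) a b → (x ≡ a × y ≡ b) ⊎ Consec (y ∷ L) a b
      unfold now = inj₁ (refl , refl)
      unfold (later C) = inj₂ C

  length-∷ʳ : ∀ (xs : List A) {x} → length (xs ∷ʳ x) ≡ suc (length xs)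
  length-∷ʳ xs = trans (length-++ xs) (+-comm (length xs) 1)

  Unique-rotate₁ : ∀ {x} {xs : List A} → Unique (x ∷ xs) → Unique (xs ∷ʳ x)
  Unique-rotate₁ (x∉xs ∷ xs!) =
    Unique-++⁺ xs! ([] ∷ []) λ { (x∈xs , here refl) → All.lookup x∉xs x∈xs refl }

  rotation-invariant : (P : List A → Set) → (∀ {x xs} → P (x ∷ xs) → P (xs ∷ʳ x)) →
                       ∀ X {Y} → P (X ++ Y) → P (Y ++ X)
  rotation-invariant P rotate₁ [] {Y} p = subst P (sym (++-identityʳ Y)) p
  rotation-invariant P rotate₁ (x ∷ X) {Y} p =
    subst P (++-assoc Y [ x ] X)
      (rotation-invariant P rotate₁ X (subst P (++-assoc X Y [ x ]) (rotate₁ p)))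

  module _ {R : A → A → Set} where

    consec⇒R : ∀ {L a b} → Consec L a b → Linked R L → R a b
    consec⇒R now (r ∷ _) = r
    consec⇒R (later C) l = consec⇒R C (Linked.tail l)

    consec⇒Linked : ∀ {L} → (∀ {a b} → Consec L a b → R a b) → Linked R L
    consec⇒Linked {[]} _ = []
    consec⇒Linked {_ ∷ []} _ = [-]
    consec⇒Linked {_ ∷ _ ∷ _} r = r now ∷ consec⇒Linked (r ∘ later)

    Linked-∷ʳ⁻ : ∀ X {y} → Linked R (X ∷ʳ y) → Linked R X
    Linked-∷ʳ⁻ [] _ = []
    Linked-∷ʳ⁻ (_ ∷ []) _ = [-]
    Linked-∷ʳ⁻ (_ ∷ z ∷ X) (r ∷ l) = r ∷ Linked-∷ʳ⁻ (z ∷ X) l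

    Linked-∷ʳ : ∀ X {x y} → Linked R (X ∷ʳ x) → R x y → Linked R (X ∷ʳ x ∷ʳ y)
    Linked-∷ʳ [] [-] r = r ∷ [-]
    Linked-∷ʳ (_ ∷ []) (r′ ∷ [-]) r = r′ ∷ r ∷ [-]
    Linked-∷ʳ (_ ∷ z ∷ X) (r′ ∷ l) r = r′ ∷ Linked-∷ʳ (z ∷ X) l r

    Linked-closeUp-rotate₁ : ∀ {x} xs → Linked R (closeUp (x ∷ xs)) → Linked R (closeUp (xs ∷ʳ x))
    Linked-closeUp-rotate₁ [] l = l
    Linked-closeUp-rotate₁ (y ∷ ys) (r ∷ l) = Linked-∷ʳ (y ∷ ys) l r

  sum-map-cong-∈ : ∀ {f g : A → ℕ} {L} → (∀ x → x ∈ L → f x ≡ g x) → sum (map f L) ≡ sum (map g L)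
  sum-map-cong-∈ agree = cong sum (map-cong-local (All.tabulate (agree _)))

  sum-map-suc-at : ∀ {f g : A → ℕ} {w L} → Unique L → w ∈ L → (∀ x → x ∈ L → x ≢ w → f x ≡ g x) →
                   g w ≡ suc (f w) → sum (map g L) ≡ suc (sum (map f L))
  sum-map-suc-at (w∉L ∷ _) (here refl) agree gw≡ =
    cong₂ _+_ gw≡
      (sym (sum-map-cong-∈ λ x x∈L → agree x (there x∈L) λ { refl → All.lookup w∉L x∈L refl }))
  sum-map-suc-at {f} (x∉L ∷ L!) (there w∈L) agree gw≡ =
    trans (cong₂ _+_ (sym (agree _ (here refl) (All.lookup x∉L w∈L)))
                     (sum-map-suc-at L! w∈L (λ y → agree y ∘ there) gw≡))
          (+-suc (f _) _)

  module _ (_≟_ : DecidableEquality A) where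
    open DecMembership _≟_ using (_∈?_)

    sum-map-pred-at : ∀ {f g : A → ℕ} {w L} → Unique L → (∀ x → x ∈ L → x ≢ w → f x ≡ g x) →
                      f w ≡ g w ∸ 1 →
                      sum (map f L) ≡ sum (map g L) ⊎ sum (map f L) ≡ sum (map g L) ∸ 1
    sum-map-pred-at {f} {g} {w} {L} L! agree fw≡ with w ∈? L
    ... | no w∉L = inj₁ (sum-map-cong-∈ λ x x∈L → agree x x∈L λ { refl → w∉L x∈L })
    ... | yes w∈L = by-value (g w) refl
      where
        by-value : ∀ k → g w ≡ k →
                   sum (map f L) ≡ sum (map g L) ⊎ sum (map f L) ≡ sum (map g L) ∸ 1
        by-value zero gw≡0 = inj₁ (sum-map-cong-∈ agree′)
          where
            agree′ : ∀ x → x ∈ L → f x ≡ g x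
            agree′ x x∈L with x ≟ w
            ... | yes refl = trans (trans fw≡ (cong (_∸ 1) gw≡0)) (sym gw≡0)
            ... | no x≢w = agree x x∈L x≢w
        by-value (suc k) gw≡ =
          inj₂ (cong (_∸ 1) (sym (sum-map-suc-at L! w∈L agree
            (trans gw≡ (cong suc (sym (trans fw≡ (cong (_∸ 1) gw≡))))))))

∧-trueˡ : ∀ p {q} → p ∧ q ≡ true → p ≡ true
∧-trueˡ true _ = refl
∧-trueˡ false ()

∧-guarded : ∀ p q → (p ≡ true → q ≡ true) → p ∧ q ≡ p ∧ true
∧-guarded true q q! = q! refl
∧-guarded false q _ = refl

module _ {n : ℕ} where

  Adj : Graph n → Fin n → Fin n → Set
  Adj G x y = G x y ≡ true

  _⊆ᴳ_ : Graph n → Graph n → Set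
  H ⊆ᴳ K = ∀ {x y} → Adj H x y → Adj K x y

  Undirected : Graph n → Set
  Undirected H = ∀ {x y} → Adj H x y → Adj H y x

  Closed : Graph n → VSet n → Set
  Closed H S = ∀ {x y} → S x ≡ true → Adj H x y → S y ≡ true

  CycEdge? : ∀ c u v → Dec (CycEdge {n} c u v)
  CycEdge? c u v = consec? _≟ᶠ_ (closeUp c) u v ⊎-dec consec? _≟ᶠ_ (closeUp c) v u

  module _ {H : Graph n} {S : VSet n} where

    _◅◅_ : ∀ {x y z} → Walk H S x y → Walk H S y z → Walk H S x z
    here _ ◅◅ w = w
    step sx e w ◅◅ w′ = step sx e (w ◅◅ w′)

    snoc : ∀ {x y z} → Walk H S x y → S z ≡ true → Adj H y z → Walk H S x z
    snoc (here sy) sz e = step sy e (here sz)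
    snoc (step sx e w) sz e′ = step sx e (snoc w sz e′)

    reverse : Undirected H → ∀ {x y} → Walk H S x y → Walk H S y x
    reverse undirected (here sx) = here sx
    reverse undirected (step sx e w) = snoc (reverse undirected w) sx (undirected e)

    visits : ∀ {x y} → Walk H S x y → List (Fin n)
    visits (here _) = []
    visits (step {z = z} _ _ w) = z ∷ visits w

    IsPath : ∀ {x y} → Walk H S x y → Set
    IsPath {x} W = Unique (x ∷ visits W)

    consec-visits-∷ʳ : ∀ {x y} d (W : Walk H S x y) → Consec (x ∷ visits W ∷ʳ d) y d
    consec-visits-∷ʳ d (here _) = now
    consec-visits-∷ʳ d (step _ _ w) = later (consec-visits-∷ʳ d w)

    three-≤-vertices : ∀ {x y} (W : Walk H S x y) → x ≢ y → ¬ Adj H x y → 3 ≤ length (x ∷ visits W)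
    three-≤-vertices (here _) x≢y _ = ⊥-elim (x≢y refl)
    three-≤-vertices (step _ e (here _)) _ ¬xy = ⊥-elim (¬xy e)
    three-≤-vertices (step _ _ (step _ _ _)) _ _ = s≤s (s≤s (s≤s z≤n))

  map-walk : ∀ {H K : Graph n} {S x y} → H ⊆ᴳ K → Walk H S x y → Walk K S x y
  map-walk sub (here sx) = here sx
  map-walk sub (step sx e w) = step sx (sub e) (map-walk sub w)

  module _ {H : Graph n} where

    restrict : ∀ {S x y} → Closed H S → S x ≡ true → Walk H full x y → Walk H S x y
    restrict closed sx (here _) = here sx
    restrict closed sx (step _ e w) = step sx e (restrict closed (closed sx e) w)

    linked⇒walk : ∀ {x y} M → Linked (Adj H) (x ∷ M ∷ʳ y) → Walk H full x y
    linked⇒walk [] (e ∷ [-]) = step refl e (here refl)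
    linked⇒walk (m ∷ M) (e ∷ l) = step refl e (linked⇒walk M l)

    Linked-visits-∷ʳ : ∀ {K x y z} → H ⊆ᴳ K → (W : Walk H full x y) → Adj K y z →
                       Linked (Adj K) (x ∷ visits W ∷ʳ z)
    Linked-visits-∷ʳ sub (here _) e = e ∷ [-]
    Linked-visits-∷ʳ sub (step _ e w) e′ = sub e ∷ Linked-visits-∷ʳ sub w e′

    Linked⇒All-in-closed : ∀ {S x L} → Closed H S → S x ≡ true → Linked (Adj H) (x ∷ L) →
                           All (λ y → S y ≡ true) (x ∷ L)
    Linked⇒All-in-closed closed sx [-] = sx ∷ []
    Linked⇒All-in-closed closed sx (e ∷ l) = sx ∷ Linked⇒All-in-closed closed (closed sx e) l

    suffix-path : ∀ {x y z} (P : Walk H full z y) → x ∈ z ∷ visits P → IsPath P →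
                  Σ (Walk H full x y) IsPath
    suffix-path P (here refl) P! = P , P!
    suffix-path (step _ _ P) (there x∈) (_ ∷ P!) = suffix-path P x∈ P!

    walk⇒path : ∀ {x y} → Walk H full x y → Σ (Walk H full x y) IsPath
    walk⇒path (here sx) = here sx , [] ∷ []
    walk⇒path {x} (step sx e W) with walk⇒path W
    ... | P , P! with DecMembership._∈?_ _≟ᶠ_ x (visits (step sx e P))
    ...   | yes x∈ = suffix-path P x∈ P!
    ...   | no x∉ = step sx e P , ¬Any⇒All¬ _ x∉ ∷ P!

    path⇒cycle : ∀ {K x y} → H ⊆ᴳ K → (P : Walk H full x y) → IsPath P → x ≢ y → ¬ Adj H x y →
                 Adj K y x → IsCycle K full (x ∷ visits P)
    path⇒cycle sub P P! x≢y ¬xy yx =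
      three-≤-vertices P x≢y ¬xy , P! , All.tabulate (λ _ → refl) , Linked-visits-∷ʳ sub P yx

    reachable-component : Undirected H → (Q : VSet n) {ρ : Fin n} →
                          (∀ {x} → Q x ≡ true → Walk H full ρ x) →
                          (∀ {x} → Walk H full ρ x → Q x ≡ true) → IsComponent H Q
    reachable-component undirected Q {ρ} to from = (ρ , from (here refl)) , connected , λ _ _ → closed
      where
        closed : Closed H Q
        closed qx e = from (snoc (to qx) refl e)
        connected : Connected H Q
        connected x y qx qy = restrict closed qx (reverse undirected (to qx) ◅◅ to qy)

    degIn-closed : ∀ {S x} → Closed H S → S x ≡ true → degIn H S x ≡ degIn H full x
    degIn-closed {S} {x} closed sx =
      cong sum (map-cong (λ y → cong (λ t → if t then 1 else 0) (∧-guarded (H x y) (S y) (closed sx)))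
                         (allFin n))

  degIn-cong : ∀ {H K : Graph n} {S} x → (∀ y → H x y ≡ K x y) → degIn H S x ≡ degIn K S x
  degIn-cong {S = S} x eq = cong sum (map-cong (λ y → cong (λ t → if t ∧ S y then 1 else 0) (eq y)) (allFin n))

  IsCycle-⊆ : ∀ {H K : Graph n} {S c} → H ⊆ᴳ K → IsCycle H S c → IsCycle K full c
  IsCycle-⊆ sub (len , c! , _ , l) = len , c! , All.tabulate (λ _ → refl) , Linked.map sub l

  SameCycle-∈ : ∀ {z : Fin n} {zs c′ x} → SameCycle (z ∷ zs) c′ → x ∈ z ∷ zs → x ∈ c′
  SameCycle-∈ {z} same x∈ with ∈⇒consec-∷ʳ z x∈
  ... | y , C with proj₁ (same _ y) (inj₁ C)
  ...   | inj₁ C′ = ∈-closeUp⁻ (consec⇒∈ˡ C′)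
  ...   | inj₂ C′ = ∈-closeUp⁻ (consec⇒∈ʳ C′)

  module _ {G : Graph n} {S : VSet n} where

    IsCycle-rotate₁ : ∀ {x xs} → IsCycle G S (x ∷ xs) → IsCycle G S (xs ∷ʳ x)
    IsCycle-rotate₁ {x} {xs} (len , c! , sx ∷ sxs , l) =
      subst (3 ≤_) (sym (length-∷ʳ xs)) len , Unique-rotate₁ c! , ∷ʳ⁺ sxs sx , Linked-closeUp-rotate₁ xs l

    IsCycle-rotate : ∀ X {Y} → IsCycle G S (X ++ Y) → IsCycle G S (Y ++ X)
    IsCycle-rotate = rotation-invariant (IsCycle G S) IsCycle-rotate₁

    IsCycle-rotate-to : ∀ {c a b} → IsCycle G S c → Consec (closeUp c) a b →
                        ∃ λ M → IsCycle G S (b ∷ M ∷ʳ a)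
    IsCycle-rotate-to {x ∷ xs} {a} {b} cyc C with consec-∷ʳ⁻ (x ∷ xs) C
    ... | inj₁ (P , Q , c≡) =
      Q ++ P , subst (IsCycle G S) (cong (b ∷_) (sym (++-assoc Q P [ a ])))
                 (IsCycle-rotate (P ∷ʳ a) (subst (IsCycle G S) (trans c≡ (sym (++-assoc P [ a ] (b ∷ Q)))) cyc))
    ... | inj₂ ([] , refl , _) with s≤s () ← proj₁ cyc
    ... | inj₂ (_ ∷ M , refl , refl) = M , cyc

  ==-refl : (x : Fin n) → (x == x) ≡ true
  ==-refl x with x ≟ᶠ x
  ... | yes _ = refl
  ... | no x≢x = ⊥-elim (x≢x refl)

  ==-pair-false : ∀ {x a y b : Fin n} → ¬ (x ≡ a × y ≡ b) → (x == a ∧ y == b) ≡ false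
  ==-pair-false {x} {a} {y} {b} ¬eq with x ≟ᶠ a | y ≟ᶠ b
  ... | yes refl | yes refl = ⊥-elim (¬eq (refl , refl))
  ... | yes _ | no _ = refl
  ... | no _ | _ = refl

  module _ (G : Graph n) where

    deleteEdge-⊆ : ∀ {a b} → deleteEdge G a b ⊆ᴳ G
    deleteEdge-⊆ {x = x} {y} = ∧-trueˡ (G x y)

    deleteEdge-comm : ∀ {a b} x y → deleteEdge G a b x y ≡ deleteEdge G b a x y
    deleteEdge-comm {a} {b} x y = cong (λ t → G x y ∧ not t) (∨-comm (x == a ∧ y == b) (x == b ∧ y == a))

    deleteEdge-swap : ∀ {a b} → deleteEdge G a b ⊆ᴳ deleteEdge G b a
    deleteEdge-swap {x = x} {y} e = trans (sym (deleteEdge-comm x y)) e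

    deleteEdge-undirected : ∀ {a b} → (∀ x y → G x y ≡ G y x) → Undirected (deleteEdge G a b)
    deleteEdge-undirected {a} {b} G-sym {x} {y} e = trans (sym swapped) e
      where
        swapped : deleteEdge G a b x y ≡ deleteEdge G a b y x
        swapped = cong₂ (λ p q → p ∧ not q) (G-sym x y)
                    (trans (cong₂ _∨_ (∧-comm (x == a) (y == b)) (∧-comm (x == b) (y == a)))
                           (∨-comm (y == b ∧ x == a) (y == a ∧ x == b)))

    deleteEdge-removes : ∀ {a b} → deleteEdge G a b a b ≡ false
    deleteEdge-removes {a} {b} rewrite ==-refl a | ==-refl b = ∧-zeroʳ (G a b)

    deleteEdge-keeps : ∀ {a b x y} → ¬ (x ≡ a × y ≡ b) → ¬ (x ≡ b × y ≡ a) → deleteEdge G a b x y ≡ G x y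
    deleteEdge-keeps {x = x} {y} ¬ab ¬ba rewrite ==-pair-false ¬ab | ==-pair-false ¬ba = ∧-identityʳ (G x y)

    deleteEdge-preserves : ∀ {a b x y} → ¬ (x ≡ a × y ≡ b) → ¬ (x ≡ b × y ≡ a) → Adj G x y →
                           Adj (deleteEdge G a b) x y
    deleteEdge-preserves ¬ab ¬ba e = trans (deleteEdge-keeps ¬ab ¬ba) e

    avoiding⇒Linked-deleteEdge : ∀ {a b L} → All (b ≢_) L → Linked (Adj G) L →
                                 Linked (Adj (deleteEdge G a b)) L
    avoiding⇒Linked-deleteEdge _ [] = []
    avoiding⇒Linked-deleteEdge _ [-] = [-]
    avoiding⇒Linked-deleteEdge (b≢x ∷ b≢y ∷ b∉L) (e ∷ l) =
      deleteEdge-preserves (λ (_ , y≡b) → b≢y (sym y≡b)) (λ (x≡b , _) → b≢x (sym x≡b)) e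
        ∷ avoiding⇒Linked-deleteEdge (b≢y ∷ b∉L) l

    -- Its vertices being distinct and at least three, the cycle b, m, …, a, b
    -- uses the edge ab only as its closing edge.
    cycle-detour : ∀ {a b M S} → IsCycle G S (b ∷ M ∷ʳ a) → Walk (deleteEdge G a b) full b a
    cycle-detour {M = []} (s≤s (s≤s ()) , _)
    cycle-detour {a} {b} {m ∷ M} (_ , (b∉ ∷ m∉ ∷ _) , _ , bm ∷ l) =
      step refl
        (deleteEdge-preserves (λ (b≡a , _) → All.lookup b∉ a∈ b≡a) (λ (_ , m≡a) → All.lookup m∉ a∈M m≡a) bm)
        (linked⇒walk M (avoiding⇒Linked-deleteEdge b∉ (Linked-∷ʳ⁻ (m ∷ M ∷ʳ a) l)))
      where
        a∈M : a ∈ M ∷ʳ a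
        a∈M = ∈-++⁺ʳ M (here refl)
        a∈ : a ∈ m ∷ M ∷ʳ a
        a∈ = there a∈M

    deleteEdge-degree : ∀ {a b} → Adj G a b → degIn G full a ≡ suc (degIn (deleteEdge G a b) full a)
    deleteEdge-degree {a} {b} ab = sum-map-suc-at (allFin⁺ n) (∈-allFin b) agree at-b
      where
        edge : Bool → ℕ
        edge t = if t ∧ true then 1 else 0
        agree : ∀ y → y ∈ allFin n → y ≢ b → edge (deleteEdge G a b a y) ≡ edge (G a y)
        agree y _ y≢b =
          cong edge (deleteEdge-keeps (λ (_ , y≡b) → y≢b y≡b) (λ (a≡b , y≡a) → y≢b (trans y≡a a≡b)))
        at-b : edge (G a b) ≡ suc (edge (deleteEdge G a b a b))
        at-b = trans (cong edge ab) (cong (suc ∘ edge) (sym deleteEdge-removes))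

    deleteEdge-degree-other : ∀ {a b S x} → x ≢ a → x ≢ b → degIn (deleteEdge G a b) S x ≡ degIn G S x
    deleteEdge-degree-other {a} {b} {x = x} x≢a x≢b =
      degIn-cong {H = deleteEdge G a b} {K = G} x
        (λ y → deleteEdge-keeps (λ (x≡a , _) → x≢a x≡a) (λ (x≡b , _) → x≢b x≡b))

module Split {n : ℕ} {H : Graph n} (undirected : Undirected H) {r s : Fin n}
             (reach : ∀ x → Walk H full r x ⊎ Walk H full s x) (apart : ¬ Walk H full r s) where

  from-r? : ∀ x → Dec (Walk H full r x)
  from-r? x with reach x
  ... | inj₁ w = yes w
  ... | inj₂ w = no λ w′ → apart (w′ ◅◅ reverse undirected w)

  S T : VSet n
  S x = does (from-r? x)
  T x = not (S x)

  S⇒walk : ∀ {x} → S x ≡ true → Walk H full r x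
  S⇒walk {x} with from-r? x
  ... | yes w = λ _ → w
  ... | no _ = λ ()

  walk⇒S : ∀ {x} → Walk H full r x → S x ≡ true
  walk⇒S {x} = dec-true (from-r? x)

  T⇒walk : ∀ {x} → T x ≡ true → Walk H full s x
  T⇒walk {x} with reach x
  ... | inj₁ _ = λ ()
  ... | inj₂ w = λ _ → w

  walk⇒T : ∀ {x} → Walk H full s x → T x ≡ true
  walk⇒T {x} w = cong not (dec-false (from-r? x) λ w′ → apart (w′ ◅◅ reverse undirected w))

  two-components : TwoComponents H S T
  two-components =
    reachable-component undirected S S⇒walk walk⇒S ,
    reachable-component undirected T T⇒walk walk⇒T ,
    λ _ → refl

UnicyclicSplit : ∀ {n} → Graph n → ℕ → Set
UnicyclicSplit {n} H k = Σ (VSet n) λ S → Σ (VSet n) λ T →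
  TwoComponents H S T × UnicyclicWithBranches H S k × Forest H T

branches : ℕ → ℕ
branches d = if 3 ≤ᵇ d then d ∸ 2 else 0

branches-suc : ∀ d → branches d ≡ branches (suc d) ∸ 1
branches-suc 0 = refl
branches-suc 1 = refl
branches-suc 2 = refl
branches-suc (suc (suc (suc d))) = refl

module EdgeDeletion {n : ℕ} (G : Graph n) (simple : Simple G) {u v : Fin n} (uv : Adj G u v) where

  G′ : Graph n
  G′ = deleteEdge G u v

  G′⊆G : G′ ⊆ᴳ G
  G′⊆G = deleteEdge-⊆ G

  G′-undirected : Undirected G′
  G′-undirected = deleteEdge-undirected G (proj₁ simple)

  u≢v : u ≢ v
  u≢v refl with () ← trans (sym uv) (proj₂ simple u)

  ¬G′uv : ¬ Adj G′ u v
  ¬G′uv e with () ← trans (sym e) (deleteEdge-removes G)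

  ¬G′vu : ¬ Adj G′ v u
  ¬G′vu = ¬G′uv ∘ G′-undirected

  degree-u : degIn G full u ≡ suc (degIn G′ full u)
  degree-u = deleteEdge-degree G uv

  degree-v : degIn G full v ≡ suc (degIn G′ full v)
  degree-v = trans (deleteEdge-degree G (trans (proj₁ simple v u) uv))
                   (cong suc (degIn-cong {H = deleteEdge G v u} {K = G′} v (deleteEdge-comm G v)))

  degree-other : ∀ {x} → x ≢ u → x ≢ v → degIn G′ full x ≡ degIn G full x
  degree-other = deleteEdge-degree-other G

  reach-after-deletion : ∀ {a x} → Walk G full a x → Walk G′ full a x ⊎ Walk G′ full u x ⊎ Walk G′ full v x
  reach-after-deletion (here _) = inj₁ (here refl)
  reach-after-deletion (step {z = z} _ e w) with reach-after-deletion w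
  ... | inj₂ w′ = inj₂ w′
  ... | inj₁ w′ with z ≟ᶠ u | z ≟ᶠ v
  ...   | yes refl | _ = inj₂ (inj₁ w′)
  ...   | no _ | yes refl = inj₂ (inj₂ w′)
  ...   | no z≢u | no z≢v =
    inj₁ (step refl (deleteEdge-preserves G (λ (_ , z≡v) → z≢v z≡v) (λ (_ , z≡u) → z≢u z≡u) e) w′)

  reach : Connected G full → ∀ x → Walk G′ full u x ⊎ Walk G′ full v x
  reach conn x = [ inj₁ , id ]′ (reach-after-deletion (conn u x refl refl))

  module OnCycle {c} (c-cycle : IsCycle G full c) (only-c : ∀ c′ → IsCycle G full c′ → SameCycle c c′)
                 (uv∈c : CycEdge c u v) where

    detour : Walk G′ full v u
    detour = [ (λ C → cycle-detour G (proj₂ (IsCycle-rotate-to c-cycle C)))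
             , (λ C → reverse G′-undirected (map-walk (deleteEdge-swap G)
                        (cycle-detour G (proj₂ (IsCycle-rotate-to c-cycle C)))))
             ]′ uv∈c

    acyclic : Acyclic G′ full
    acyclic c′ cyc′@(_ , _ , _ , linked′) with proj₁ (only-c c′ (IsCycle-⊆ G′⊆G cyc′) u v) uv∈c
    ... | inj₁ C = ¬G′uv (consec⇒R C linked′)
    ... | inj₂ C = ¬G′vu (consec⇒R C linked′)

    tree : Connected G full → Tree G′
    tree conn = (λ x y _ _ → reverse G′-undirected (from-u x) ◅◅ from-u y) , acyclic
      where
        from-u : ∀ x → Walk G′ full u x
        from-u x = [ id , reverse G′-undirected detour ◅◅_ ]′ (reach conn x)

  module OffCycle {x₀ cs} (c-cycle : IsCycle G full (x₀ ∷ cs))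
                  (only-c : ∀ c′ → IsCycle G full c′ → SameCycle (x₀ ∷ cs) c′)
                  (uv∉c : ¬ CycEdge (x₀ ∷ cs) u v) where

    c : List (Fin n)
    c = x₀ ∷ cs

    cycle-survives : Linked (Adj G′) (closeUp c)
    cycle-survives = consec⇒Linked λ C →
      deleteEdge-preserves G (λ { (refl , refl) → uv∉c (inj₁ C) }) (λ { (refl , refl) → uv∉c (inj₂ C) })
        (consec⇒R C (proj₂ (proj₂ (proj₂ c-cycle))))

    bridge : ¬ Walk G′ full v u
    bridge w with walk⇒path w
    ... | P , P! = uv∉c (proj₂ (only-c _ (path⇒cycle G′⊆G P P! (u≢v ∘ sym) ¬G′vu uv) u v)
                               (inj₁ (consec-visits-∷ʳ v P)))

    module Side {r s} (reach′ : ∀ x → Walk G′ full r x ⊎ Walk G′ full s x) (apart : ¬ Walk G′ full r s)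
                (r↝x₀ : Walk G′ full r x₀) (degree-r : degIn G full r ≡ suc (degIn G′ full r))
                (degree-others : ∀ {x} → x ≢ r → x ≢ s → degIn G′ full x ≡ degIn G full x) where

      open Split G′-undirected reach′ apart

      S-closed : Closed G′ S
      S-closed = proj₂ (proj₂ (proj₁ two-components)) _ _

      c⊆S : All (λ x → S x ≡ true) c
      c⊆S = ++⁻ˡ c (Linked⇒All-in-closed S-closed (walk⇒S r↝x₀) cycle-survives)

      cycle-avoids-s : ∀ {x} → x ∈ c → x ≢ s
      cycle-avoids-s x∈c refl = apart (S⇒walk (All.lookup c⊆S x∈c))

      ucd-drop : ucd G′ S c ≡ ucd G full c ⊎ ucd G′ S c ≡ ucd G full c ∸ 1
      ucd-drop = sum-map-pred-at _≟ᶠ_ {f = branches ∘ degIn G′ S} {g = branches ∘ degIn G full}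
                   (proj₁ (proj₂ c-cycle)) agree at-r
        where
          open ≡-Reasoning
          agree : ∀ x → x ∈ c → x ≢ r → branches (degIn G′ S x) ≡ branches (degIn G full x)
          agree x x∈c x≢r = cong branches
            (trans (degIn-closed {x = x} S-closed (All.lookup c⊆S x∈c))
                   (degree-others x≢r (cycle-avoids-s x∈c)))
          at-r : branches (degIn G′ S r) ≡ branches (degIn G full r) ∸ 1
          at-r = begin
            branches (degIn G′ S r)
              ≡⟨ cong branches (degIn-closed {x = r} S-closed (walk⇒S (here refl))) ⟩
            branches (degIn G′ full r)
              ≡⟨ branches-suc (degIn G′ full r) ⟩
            branches (suc (degIn G′ full r)) ∸ 1
              ≡⟨ cong (λ d → branches d ∸ 1) (sym degree-r) ⟩
            branches (degIn G full r) ∸ 1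
              ∎

      forest-T : Forest G′ T
      forest-T c′ cyc′@(_ , _ , c′⊆T , _) =
        apart (r↝x₀ ◅◅ reverse G′-undirected (T⇒walk (All.lookup c′⊆T x₀∈c′)))
        where
          x₀∈c′ : x₀ ∈ c′
          x₀∈c′ = SameCycle-∈ (only-c c′ (IsCycle-⊆ G′⊆G cyc′)) (here refl)

      unicyclic-S : ∀ {k} → ucd G′ S c ≡ k → UnicyclicWithBranches G′ S k
      unicyclic-S ucd≡ =
        proj₁ (proj₂ (proj₁ two-components)) ,
        c , ((proj₁ c-cycle , proj₁ (proj₂ c-cycle) , c⊆S , cycle-survives) ,
             λ c′ cyc′ → only-c c′ (IsCycle-⊆ G′⊆G cyc′)) , ucd≡

      result : UnicyclicSplit G′ (ucd G full c) ⊎ UnicyclicSplit G′ (ucd G full c ∸ 1)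
      result = ⊎-map split split ucd-drop
        where
          split : ∀ {k} → ucd G′ S c ≡ k → UnicyclicSplit G′ k
          split ucd≡ = S , T , two-components , unicyclic-S ucd≡ , forest-T

    splits : Connected G full → UnicyclicSplit G′ (ucd G full c) ⊎ UnicyclicSplit G′ (ucd G full c ∸ 1)
    splits conn with reach conn x₀
    ... | inj₁ u↝x₀ = Side.result (reach conn) (bridge ∘ reverse G′-undirected) u↝x₀ degree-u degree-other
    ... | inj₂ v↝x₀ =
      Side.result (swap ∘ reach conn) bridge v↝x₀ degree-v (λ x≢v x≢u → degree-other x≢u x≢v)

lemma1 : (n : ℕ) (G : Graph n) → Simple G →
    (c : List (Fin n)) → Connected G full → UniqueCycle G full c →
    (u v : Fin n) → G u v ≡ true →
    Tree (deleteEdge G u v)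
    ⊎ Σ (VSet n) (λ S → Σ (VSet n) (λ T →
        TwoComponents (deleteEdge G u v) S T
        × UnicyclicWithBranches (deleteEdge G u v) S (ucd G full c)
        × Forest (deleteEdge G u v) T))
    ⊎ Σ (VSet n) (λ S → Σ (VSet n) (λ T →
        TwoComponents (deleteEdge G u v) S T
        × UnicyclicWithBranches (deleteEdge G u v) S (ucd G full c ∸ 1)
        × Forest (deleteEdge G u v) T))
lemma1 n G simple [] conn ((() , _) , _) u v uv
lemma1 n G simple (x₀ ∷ cs) conn (c-cycle , only-c) u v uv with CycEdge? (x₀ ∷ cs) u v
... | yes uv∈c = inj₁ (EdgeDeletion.OnCycle.tree G simple uv c-cycle only-c uv∈c conn)
... | no uv∉c = inj₂ (EdgeDeletion.OffCycle.splits G simple uv c-cycle only-c uv∉c conn)
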